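{- Let $S$ be an SSKT of shape $\mathbf a\in\mathbb N^n$, let $r<s$ be rows with $\mathbf a_r>\mathbf a_s$, and let $c>1$ be a column with $(c,s)\in\mathbb D(\mathbf a)$ and $S(c,r)<S(c,s)$. Then $S(c-1,r)<S(c-1,s)$.
   Context: Cells $(c,r)$: column $c$, row $r$, row 1 at the bottom. $\mathbb D(\mathbf a)=\{(c,r)\in\mathbb Z_{>0}\times[n]:c\le\mathbf a_r\}$. A filling $T:\mathbb D(\mathbf a)\to[n]$; $\hat T$ extends it by basement cells $(0,i)$ with $\hat T(0,i)=i$. Cells attack if in the same column or in adjacent columns with the left one strictly higher. An SSKT is a filling such that no two attacking cells of $\hat T$ have equal entries, entries of $\hat T$ weakly decrease left to right along rows, and there is no co-inversion triple: three cells of $\hat T$ with distinct entries of the form $(c,r),(c+1,r),(c,s)$ with $r<s$, $\mathbf a_r>\mathbf a_s$, or $(c+1,r),(c,s),(c+1,s)$ with $r<s$, $\mathbf a_r\le\mathbf a_s$ ($c\ge0$), such that with $k,i$ the left and right entries in the common row and $j$ the third entry, $i<j<k$ or $j<k<i$ or $k<i<j$. -}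

module Defs where

open import Data.Nat using (ℕ; zero; suc; _+_; _∸_; _≤_; _<_; _>_)
open import Data.Fin using (Fin)
import Data.Fin as F
open import Data.Product using (_×_; _,_)
open import Data.Sum using (_⊎_)
open import Relation.Binary.PropositionalEquality using (_≡_; _≢_)
open import Relation.Nullary using (¬_)

-- A composition/shape a ∈ ℕ^n is a function Fin n → ℕ.
-- Rows are numbered 1..n (row 1 at the bottom); columns are natural numbers,
-- with column 0 the basement.

-- 0-based lookup into the shape (0 outside the range)
at0 : ∀ {n} → (Fin n → ℕ) → ℕ → ℕ
at0 {zero}  a _       = 0
at0 {suc n} a zero    = a F.zero
at0 {suc n} a (suc k) = at0 (λ i → a (F.suc i)) k

row : ∀ {n} → (Fin n → ℕ) → ℕ → ℕ
row a r = at0 a (r ∸ 1)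

IsRow : ℕ → ℕ → Set
IsRow n r = 1 ≤ r × r ≤ n

InD : ∀ {n} → (Fin n → ℕ) → ℕ → ℕ → Set
InD {n} a c r = 1 ≤ c × IsRow n r × c ≤ row a r

InHat : ∀ {n} → (Fin n → ℕ) → ℕ → ℕ → Set
InHat {n} a c r = InD a c r ⊎ (c ≡ 0 × IsRow n r)

-- A filling is given as a function (column ↦ row ↦ entry); only its values on
-- D(a) matter.
Filling : Set
Filling = ℕ → ℕ → ℕ

hat : Filling → ℕ → ℕ → ℕ
hat T zero    r = r
hat T (suc c) r = T (suc c) r

EntriesInRange : ∀ {n} → (Fin n → ℕ) → Filling → Set
EntriesInRange {n} a T = ∀ c r → InD a c r → 1 ≤ T c r × T c r ≤ n

Attack : ℕ → ℕ → ℕ → ℕ → Set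
Attack c₁ r₁ c₂ r₂ =
  (c₁ ≡ c₂ × r₁ ≢ r₂) ⊎ (suc c₁ ≡ c₂ × r₁ > r₂) ⊎ (suc c₂ ≡ c₁ × r₂ > r₁)

NonAttacking : ∀ {n} → (Fin n → ℕ) → Filling → Set
NonAttacking a T = ∀ c₁ r₁ c₂ r₂ → InHat a c₁ r₁ → InHat a c₂ r₂ →
  Attack c₁ r₁ c₂ r₂ → hat T c₁ r₁ ≢ hat T c₂ r₂

RowsDecrease : ∀ {n} → (Fin n → ℕ) → Filling → Set
RowsDecrease a T = ∀ c r → InHat a c r → InHat a (suc c) r →
  hat T (suc c) r ≤ hat T c r

-- k, i: left and right entries of the common row, j: the third entry
CoinvPattern : ℕ → ℕ → ℕ → Set
CoinvPattern k i j = (i < j × j < k) ⊎ (j < k × k < i) ⊎ (k < i × i < j)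

Distinct3 : ℕ → ℕ → ℕ → Set
Distinct3 x y z = x ≢ y × y ≢ z × x ≢ z

CoinvA : ∀ {n} → (Fin n → ℕ) → Filling → ℕ → ℕ → ℕ → Set
CoinvA a T c r s =
  r < s × row a r > row a s ×
  InHat a c r × InHat a (suc c) r × InHat a c s ×
  Distinct3 (hat T c r) (hat T (suc c) r) (hat T c s) ×
  CoinvPattern (hat T c r) (hat T (suc c) r) (hat T c s)

CoinvB : ∀ {n} → (Fin n → ℕ) → Filling → ℕ → ℕ → ℕ → Set
CoinvB a T c r s =
  r < s × row a r ≤ row a s ×
  InHat a (suc c) r × InHat a c s × InHat a (suc c) s ×
  Distinct3 (hat T c s) (hat T (suc c) s) (hat T (suc c) r) ×
  CoinvPattern (hat T c s) (hat T (suc c) s) (hat T (suc c) r)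

NoCoinvTriple : ∀ {n} → (Fin n → ℕ) → Filling → Set
NoCoinvTriple a T = ∀ c r s → ¬ CoinvA a T c r s × ¬ CoinvB a T c r s

record SSKT {n : ℕ} (a : Fin n → ℕ) (T : Filling) : Set where
  field
    entries     : EntriesInRange a T
    nonAttack   : NonAttacking a T
    rowsDecr    : RowsDecrease a T
    noCoinv     : NoCoinvTriple a T

-- Since row r is longer than row s, both rows occupy columns c − 1 and c.
-- Equal entries in column c − 1 would attack; the reverse order would give
--   S (c , r) < S (c , s) ≤ S (c − 1 , s) < S (c − 1 , r)
-- (the middle step since rows decrease), i.e. a type A co-inversion triple on
-- (c − 1 , r), (c , r), (c − 1 , s).
module Submission where

open import Defs
open import Data.Nat using (ℕ; _∸_; _≤_; _<_; _>_; suc; s≤s; z≤n)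
open import Data.Nat.Properties
  using (≤-trans; <-≤-trans; <-trans; <⇒≤; <⇒≢; >⇒≢; n≤1+n; <-cmp)
open import Data.Fin using (Fin)
open import Data.Product using (_,_; proj₁)
open import Data.Sum using (inj₁)
open import Data.Empty using (⊥; ⊥-elim)
open import Relation.Binary using (Tri; tri<; tri≈; tri>)
open import Relation.Binary.PropositionalEquality using (_≡_; _≢_; refl)

module _ {n : ℕ} {a : Fin n → ℕ} where

  InD-pred : ∀ {c r} → InD a (suc (suc c)) r → InD a (suc c) r
  InD-pred (_ , isRow , c≤ar) = s≤s z≤n , isRow , ≤-trans (n≤1+n _) c≤ar

  InD-longerRow : ∀ {c r s} → IsRow n r → row a s ≤ row a r →
    InD a c s → InD a c r
  InD-longerRow isRow as≤ar (1≤c , _ , c≤as) = 1≤c , isRow , ≤-trans c≤as as≤ar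

  module _ {T : Filling} (sk : SSKT a T) where

    column-injective : ∀ {c r s} → InD a c r → InD a c s → r < s →
      T c r ≢ T c s
    column-injective {suc c} cr cs r<s =
      SSKT.nonAttack sk (suc c) _ (suc c) _ (inj₁ cr) (inj₁ cs) (inj₁ (refl , <⇒≢ r<s))

    row-decreasing : ∀ {c r} → InD a (suc c) r → InD a (suc (suc c)) r →
      T (suc (suc c)) r ≤ T (suc c) r
    row-decreasing cr cr′ = SSKT.rowsDecr sk (suc _) _ (inj₁ cr) (inj₁ cr′)

    no-increasing-coinvA : ∀ {c r s} → r < s → row a r > row a s →
      InHat a c r → InHat a (suc c) r → InHat a c s →
      hat T (suc c) r < hat T c s → hat T c s < hat T c r → ⊥
    no-increasing-coinvA r<s ar>as cr cr′ cs i<j j<k =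
      proj₁ (SSKT.noCoinv sk _ _ _)
        ( r<s , ar>as , cr , cr′ , cs
        , (>⇒≢ (<-trans i<j j<k) , <⇒≢ i<j , >⇒≢ j<k)
        , inj₁ (i<j , j<k))

lemma4p10 : (n : ℕ) (a : Fin n → ℕ) (S : Filling) → SSKT a S →
    (r s c : ℕ) → IsRow n r → IsRow n s → r < s → row a r > row a s →
    c > 1 → InD a c s → S c r < S c s →
    S (c ∸ 1) r < S (c ∸ 1) s
lemma4p10 n a S sk r s (suc (suc c)) isRow-r _ r<s ar>as (s≤s (s≤s _)) cs Scr<Scs =
  compare (<-cmp (S (suc c) r) (S (suc c) s))
  where
  cr : InD a (suc (suc c)) r
  cr = InD-longerRow isRow-r (<⇒≤ ar>as) cs

  compare : Tri (S (suc c) r < S (suc c) s) (S (suc c) r ≡ S (suc c) s)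
                (S (suc c) r > S (suc c) s) → S (suc c) r < S (suc c) s
  compare (tri< lt _ _) = lt
  compare (tri≈ _ eq _) =
    ⊥-elim (column-injective sk (InD-pred cr) (InD-pred cs) r<s eq)
  compare (tri> _ _ gt) =
    ⊥-elim (no-increasing-coinvA sk r<s ar>as
      (inj₁ (InD-pred cr)) (inj₁ cr) (inj₁ (InD-pred cs))
      (<-≤-trans Scr<Scs (row-decreasing sk (InD-pred cs) cs)) gt)
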